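{- Let $\Sigma$ be a finite alphabet, $l \geq 1$, let $T = (T_1, T_2, T_3)$ be three $l$-mers over $\Sigma$, and let $d_1, d_2, d_3$ be non-negative integers. There exists an $l$-mer $M \in \Sigma^l$ such that $Hd(M, T_i) \leq d_i$ for all $i \in \{1,2,3\}$ if and only if both of the following hold: (i) $Cd(T_i, T_j) \leq d_i + d_j$ for all $1 \leq i < j \leq 3$ (equivalently, $Hd(T_i,T_j) \leq d_i + d_j$); (ii) $Cd(T) \leq d_1 + d_2 + d_3$.
   Context: An $l$-mer is a string of length $l$ over the alphabet $\Sigma$. For $l$-mers $u, v$, the Hamming distance $Hd(u,v)$ is the number of positions $p \in \{1,\ldots,l\}$ with $u[p] \neq v[p]$. For a collection $T = (T_1,\ldots,T_k)$ of $l$-mers, the $i$-th column of $T$ is the multiset $\{T_1[i], \ldots, T_k[i]\}$; let $m_i$ be the maximum number of occurrences of any single character in column $i$. The consensus total distance of $T$ is $Cd(T) = \sum_{i=1}^{l} (k - m_i)$. For two $l$-mers $A, B$, $Cd(A,B)$ denotes the consensus total distance of the pair $(A,B)$, which equals $Hd(A,B)$. -}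

module Defs where

open import Data.Nat using (ℕ; zero; suc; _+_; _∸_; _⊔_)
open import Data.Fin using (Fin)
open import Data.Fin.Properties using (_≟_)
open import Data.Vec using (Vec; []; _∷_; lookup; toList; map)
open import Data.List using (List; length; filter; foldr; allFin)
open import Relation.Nullary using (yes; no; ¬_)

LMer : ℕ → ℕ → Set
LMer s l = Vec (Fin s) l

Hd : ∀ {s l} → LMer s l → LMer s l → ℕ
Hd [] [] = 0
Hd (a ∷ u) (b ∷ v) with a ≟ b
... | yes _ = Hd u v
... | no _  = suc (Hd u v)

count : ∀ {s} → Fin s → List (Fin s) → ℕ
count c xs = length (filter (c ≟_) xs)

maxMult : ∀ {s} → List (Fin s) → ℕ
maxMult {s} col = foldr (λ c m → count c col ⊔ m) 0 (allFin s)

column : ∀ {s l k} → Vec (LMer s l) k → Fin l → List (Fin s)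
column T i = toList (map (λ t → lookup t i) T)

Cd : ∀ {s l k} → Vec (LMer s l) k → ℕ
Cd {l = l} {k = k} T = foldr (λ i acc → (k ∸ maxMult (column T i)) + acc) 0 (allFin l)

-- A column of (T₁, T₂, T₃) has all entries equal, a single entry differing from the other
-- two (in position 1, 2 or 3), or three distinct entries; let n₁, n₂, n₃, n₄ count the
-- columns of the last four kinds. Then Hd(T₁, T₂) = n₁ + n₂ + n₄ (and symmetrically) and
-- Cd(T) = n₁ + n₂ + n₃ + 2 n₄, since the consensus cost of a column is the least number of
-- its entries that a single character disagrees with. The same characterisation gives
-- necessity: column by column, Cd(T) is at most the total distance from any M.
-- For sufficiency M is built column by column. Conditions (i) and (ii), read as linear
-- inequalities between the counts and the budgets dᵢ, survive when the character chosen
-- for the first column is charged to the budgets of the strings it disagrees with, and a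
-- case analysis on the kind of column and on which budgets are zero or have slack shows
-- that a suitable character always exists.

module Submission where

open import Defs
open import Data.Nat using (ℕ; zero; suc; _+_; _*_; _∸_; _⊔_; _≤_; _≤?_; z≤n; s≤s)
open import Data.Nat.Properties
  using (+-*-semiring; +-mono-≤; +-monoʳ-≤; +-cancelʳ-≤; +-assoc; +-comm; +-suc; +-identityʳ;
         ≤-trans; ≤-refl; ≤-reflexive; ≤-pred; ≰⇒>; m≤m+n; m≤n+m; m≤m⊔n; m≤n⊔m; ⊔-lub;
         ∸-monoʳ-≤; m+n∸m≡n; m+n≤o⇒m≤o∸n; m∸[m∸n]≡n; module ≤-Reasoning)
open import Data.Nat.Tactic.RingSolver using (solve)
open import Data.Fin using (Fin; zero; suc)
open import Data.Fin.Properties using (_≟_)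
open import Data.Vec using (Vec; []; _∷_; lookup)
import Data.Vec as Vec
open import Data.Vec.Properties using (length-toList)
open import Data.List using (List; []; _∷_; foldr; tabulate; allFin; length)
-- The variable lists given to `solve` must use an unambiguous list constructor.
open import Data.List using () renaming (_∷_ to _∷ₗ_)
open import Data.List.Membership.Propositional using (_∈_)
open import Data.List.Membership.Propositional.Properties using (∈-allFin)
open import Data.List.Relation.Unary.Any using (here; there)
open import Data.Product using (∃; _×_; _,_)
open import Data.Sum using (_⊎_; inj₁; inj₂)
import Data.Sum as Sum
open import Function using (_∘_)
open import Function.Bundles using (_⇔_; mk⇔)
open import Relation.Nullary using (yes; no; ¬_; contradiction)
open import Relation.Binary.PropositionalEquality
open import Algebra.Properties.Semiring.Sum +-*-semiring
  using (sum; sum-syntax; ∑-distrib-+; sum-cong-≗; sum-replicate-zero; *-distribˡ-sum)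

∑-mono-≤ : ∀ {n} {f g : Fin n → ℕ} → (∀ i → f i ≤ g i) → ∑[ i < n ] f i ≤ ∑[ i < n ] g i
∑-mono-≤ {zero}  f≤g = z≤n
∑-mono-≤ {suc n} f≤g = +-mono-≤ (f≤g zero) (∑-mono-≤ (λ i → f≤g (suc i)))

∑-distrib-+₃ : ∀ {n} (f g h : Fin n → ℕ) →
  ∑[ i < n ] (f i + g i + h i) ≡ ∑[ i < n ] f i + ∑[ i < n ] g i + ∑[ i < n ] h i
∑-distrib-+₃ f g h = trans (∑-distrib-+ (λ i → f i + g i) h) (cong (_+ sum h) (∑-distrib-+ f g))

foldr-tabulate≡∑ : ∀ {A : Set} n (f : A → ℕ) (g : Fin n → A) →
  foldr (λ x acc → f x + acc) 0 (tabulate g) ≡ ∑[ i < n ] f (g i)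
foldr-tabulate≡∑ zero    f g = refl
foldr-tabulate≡∑ (suc n) f g = cong (f (g zero) +_) (foldr-tabulate≡∑ n f (λ i → g (suc i)))

≤-foldr-⊔ : ∀ {A : Set} (f : A → ℕ) {x xs} → x ∈ xs → f x ≤ foldr (λ a m → f a ⊔ m) 0 xs
≤-foldr-⊔ f (here refl)                = m≤m⊔n (f _) _
≤-foldr-⊔ f {xs = y ∷ _} (there x∈xs) = ≤-trans (≤-foldr-⊔ f x∈xs) (m≤n⊔m (f y) _)

foldr-⊔-lub : ∀ {A : Set} (f : A → ℕ) xs {B} → (∀ x → f x ≤ B) → foldr (λ a m → f a ⊔ m) 0 xs ≤ B
foldr-⊔-lub f []       f≤B = z≤n
foldr-⊔-lub f (y ∷ xs) f≤B = ⊔-lub (f≤B y) (foldr-⊔-lub f xs f≤B)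

-- a ≤ b since b − a = (y − x) + k.
≤-transfer : ∀ {x y a b} k → x ≤ y → a + y + k ≡ b + x → a ≤ b
≤-transfer {x} {y} {a} {b} k x≤y eq = ≤-trans (m≤m+n a k) (+-cancelʳ-≤ y (a + k) b (begin
  a + k + y   ≡⟨ +-assoc a k y ⟩
  a + (k + y) ≡⟨ cong (a +_) (+-comm k y) ⟩
  a + (y + k) ≡⟨ +-assoc a y k ⟨
  a + y + k   ≡⟨ eq ⟩
  b + x       ≤⟨ +-monoʳ-≤ b x≤y ⟩
  b + y       ∎))
  where open ≤-Reasoning

module _ {s : ℕ} where

  mismatch : Fin s → Fin s → ℕ
  mismatch a b with a ≟ b
  ... | yes _ = 0
  ... | no  _ = 1

  mismatch-refl : ∀ a → mismatch a a ≡ 0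
  mismatch-refl a with a ≟ a
  ... | yes _  = refl
  ... | no a≢a = contradiction refl a≢a

  mismatch-≢ : ∀ {a b} → a ≢ b → mismatch a b ≡ 1
  mismatch-≢ {a} {b} a≢b with a ≟ b
  ... | yes a≡b = contradiction a≡b a≢b
  ... | no  _   = refl

  mismatch≤1 : ∀ a b → mismatch a b ≤ 1
  mismatch≤1 a b with a ≟ b
  ... | yes _ = z≤n
  ... | no  _ = s≤s z≤n

  mismatch-triangle : ∀ x a b → mismatch a b ≤ mismatch x a + mismatch x b
  mismatch-triangle x a b with x ≟ a
  ... | yes refl = ≤-refl
  ... | no  _    = ≤-trans (mismatch≤1 a b) (m≤m+n 1 _)

  Hd-∷ : ∀ {l} a b (u v : LMer s l) → Hd (a ∷ u) (b ∷ v) ≡ mismatch a b + Hd u v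
  Hd-∷ a b u v with a ≟ b
  ... | yes _ = refl
  ... | no  _ = refl

  Hd≡∑mismatch : ∀ {l} (u v : LMer s l) → Hd u v ≡ ∑[ i < l ] mismatch (lookup u i) (lookup v i)
  Hd≡∑mismatch []      []      = refl
  Hd≡∑mismatch (a ∷ u) (b ∷ v) = trans (Hd-∷ a b u v) (cong (mismatch a b +_) (Hd≡∑mismatch u v))

  mismatches : Fin s → List (Fin s) → ℕ
  mismatches x []       = 0
  mismatches x (y ∷ ys) = mismatch x y + mismatches x ys

  count+mismatches≡length : ∀ (x : Fin s) ys → count x ys + mismatches x ys ≡ length ys
  count+mismatches≡length x []       = refl
  count+mismatches≡length x (y ∷ ys) with x ≟ y
  ... | yes _ = cong suc (count+mismatches≡length x ys)
  ... | no  _ = trans (+-suc (count x ys) (mismatches x ys)) (cong suc (count+mismatches≡length x ys))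

  count≤maxMult : ∀ (x : Fin s) col → count x col ≤ maxMult col
  count≤maxMult x col = ≤-foldr-⊔ (λ c → count c col) (∈-allFin x)

  maxMult-lub : ∀ {B} (col : List (Fin s)) → (∀ x → count x col ≤ B) → maxMult col ≤ B
  maxMult-lub col = foldr-⊔-lub (λ c → count c col) (allFin s)

  ∸maxMult≤mismatches : ∀ (x : Fin s) col → length col ∸ maxMult col ≤ mismatches x col
  ∸maxMult≤mismatches x col = begin
    length col ∸ maxMult col                     ≤⟨ ∸-monoʳ-≤ (length col) (count≤maxMult x col) ⟩
    length col ∸ count x col                     ≡⟨ cong (_∸ count x col) (count+mismatches≡length x col) ⟨
    count x col + mismatches x col ∸ count x col ≡⟨ m+n∸m≡n (count x col) (mismatches x col) ⟩
    mismatches x col                             ∎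
    where open ≤-Reasoning

  ≤∸maxMult : ∀ {c} (y : Fin s) ys → (∀ x → c ≤ mismatches x (y ∷ ys)) →
    c ≤ length (y ∷ ys) ∸ maxMult (y ∷ ys)
  ≤∸maxMult {c} y ys c≤ = begin
    c                             ≡⟨ m∸[m∸n]≡n c≤length ⟨
    length col ∸ (length col ∸ c) ≤⟨ ∸-monoʳ-≤ (length col) (maxMult-lub col count≤) ⟩
    length col ∸ maxMult col      ∎
    where
    open ≤-Reasoning
    col = y ∷ ys
    count+c≤length : ∀ x → count x col + c ≤ length col
    count+c≤length x = ≤-trans (+-monoʳ-≤ (count x col) (c≤ x)) (≤-reflexive (count+mismatches≡length x col))
    count≤ : ∀ x → count x col ≤ length col ∸ c
    count≤ x = m+n≤o⇒m≤o∸n (count x col) (count+c≤length x)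
    c≤length : c ≤ length col
    c≤length = ≤-trans (m≤n+m c (count y col)) (count+c≤length y)

module _ {s l : ℕ} where

  Cd≡∑ : ∀ {k} (T : Vec (LMer s l) k) → Cd T ≡ ∑[ i < l ] (k ∸ maxMult (column T i))
  Cd≡∑ {k} T = foldr-tabulate≡∑ l (λ i → k ∸ maxMult (column T i)) (λ i → i)

  ∑mismatches≡∑Hd : ∀ {k} (M : LMer s l) (T : Vec (LMer s l) k) →
    ∑[ i < l ] mismatches (lookup M i) (column T i) ≡ Vec.sum (Vec.map (Hd M) T)
  ∑mismatches≡∑Hd M []      = sum-replicate-zero l
  ∑mismatches≡∑Hd M (t ∷ T) = begin
    ∑[ i < l ] (mismatch (lookup M i) (lookup t i) + mismatches (lookup M i) (column T i))
      ≡⟨ ∑-distrib-+ (λ i → mismatch (lookup M i) (lookup t i)) (λ i → mismatches (lookup M i) (column T i)) ⟩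
    ∑[ i < l ] mismatch (lookup M i) (lookup t i) + ∑[ i < l ] mismatches (lookup M i) (column T i)
      ≡⟨ cong₂ _+_ (sym (Hd≡∑mismatch M t)) (∑mismatches≡∑Hd M T) ⟩
    Hd M t + Vec.sum (Vec.map (Hd M) T) ∎
    where open ≡-Reasoning

  Cd≤∑Hd : ∀ {k} (M : LMer s l) (T : Vec (LMer s l) k) → Cd T ≤ Vec.sum (Vec.map (Hd M) T)
  Cd≤∑Hd {k} M T = begin
    Cd T                                            ≡⟨ Cd≡∑ T ⟩
    ∑[ i < l ] (k ∸ maxMult (column T i))           ≤⟨ ∑-mono-≤ column-cost≤ ⟩
    ∑[ i < l ] mismatches (lookup M i) (column T i) ≡⟨ ∑mismatches≡∑Hd M T ⟩
    Vec.sum (Vec.map (Hd M) T)                      ∎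
    where
    open ≤-Reasoning
    column-cost≤ : ∀ i → k ∸ maxMult (column T i) ≤ mismatches (lookup M i) (column T i)
    column-cost≤ i = subst (λ n → n ∸ maxMult (column T i) ≤ mismatches (lookup M i) (column T i))
                           (length-toList (Vec.map (λ t → lookup t i) T))
                           (∸maxMult≤mismatches (lookup M i) (column T i))

  Hd≤Cd : (u v : LMer s l) → Hd u v ≤ Cd (u ∷ v ∷ [])
  Hd≤Cd u v = begin
    Hd u v                                           ≡⟨ Hd≡∑mismatch u v ⟩
    ∑[ i < l ] mismatch (lookup u i) (lookup v i)    ≤⟨ ∑-mono-≤ (λ i → ≤∸maxMult _ _ (triangle (lookup u i) (lookup v i))) ⟩
    ∑[ i < l ] (2 ∸ maxMult (column (u ∷ v ∷ []) i)) ≡⟨ Cd≡∑ (u ∷ v ∷ []) ⟨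
    Cd (u ∷ v ∷ [])                                  ∎
    where
    open ≤-Reasoning
    triangle : ∀ a b x → mismatch a b ≤ mismatch x a + (mismatch x b + 0)
    triangle a b x rewrite +-identityʳ (mismatch x b) = mismatch-triangle x a b

  Cd-pair≤ : ∀ (M : LMer s l) {u v d₁ d₂} → Hd M u ≤ d₁ → Hd M v ≤ d₂ → Cd (u ∷ v ∷ []) ≤ d₁ + d₂
  Cd-pair≤ M {u} {v} {d₁} {d₂} h₁ h₂ =
    subst (Cd (u ∷ v ∷ []) ≤_) (cong (d₁ +_) (+-identityʳ d₂))
          (≤-trans (Cd≤∑Hd M (u ∷ v ∷ [])) (+-mono-≤ h₁ (+-mono-≤ h₂ z≤n)))

  Cd-triple≤ : ∀ (M : LMer s l) {u v w d₁ d₂ d₃} → Hd M u ≤ d₁ → Hd M v ≤ d₂ → Hd M w ≤ d₃ →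
    Cd (u ∷ v ∷ w ∷ []) ≤ d₁ + d₂ + d₃
  Cd-triple≤ M {u} {v} {w} {d₁} {d₂} {d₃} h₁ h₂ h₃ =
    subst (Cd (u ∷ v ∷ w ∷ []) ≤_) (trans (cong (λ x → d₁ + (d₂ + x)) (+-identityʳ d₃)) (sym (+-assoc d₁ d₂ d₃)))
          (≤-trans (Cd≤∑Hd M (u ∷ v ∷ w ∷ [])) (+-mono-≤ h₁ (+-mono-≤ h₂ (+-mono-≤ h₃ z≤n))))

module _ {s : ℕ} where

  data Shape : Fin s → Fin s → Fin s → Set where
    all-equal    : ∀ a → Shape a a a
    odd₁         : ∀ {a b} → a ≢ b → Shape a b b
    odd₂         : ∀ {a b} → a ≢ b → Shape b a b
    odd₃         : ∀ {a b} → a ≢ b → Shape b b a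
    all-distinct : ∀ {a b c} → a ≢ b → a ≢ c → b ≢ c → Shape a b c

  shape : ∀ a b c → Shape a b c
  shape a b c with a ≟ b | a ≟ c | b ≟ c
  ... | yes refl | yes refl | _        = all-equal a
  ... | yes refl | no  a≢c  | _        = odd₃ (≢-sym a≢c)
  ... | no  a≢b  | yes refl | _        = odd₂ (≢-sym a≢b)
  ... | no  a≢b  | no  _    | yes refl = odd₁ a≢b
  ... | no  a≢b  | no  a≢c  | no  b≢c  = all-distinct a≢b a≢c b≢c

  [odd₁] [odd₂] [odd₃] [distinct] : ∀ {a b c} → Shape a b c → ℕ
  [odd₁] (odd₁ _) = 1
  [odd₁] _        = 0
  [odd₂] (odd₂ _) = 1
  [odd₂] _        = 0
  [odd₃] (odd₃ _) = 1
  [odd₃] _        = 0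
  [distinct] (all-distinct _ _ _) = 1
  [distinct] _                    = 0

  cost : ∀ {a b c} → Shape a b c → ℕ
  cost σ = [odd₁] σ + [odd₂] σ + [odd₃] σ + 2 * [distinct] σ

  mismatch₁₂ : ∀ {a b c} (σ : Shape a b c) → mismatch a b ≡ [odd₁] σ + [odd₂] σ + [distinct] σ
  mismatch₁₂ (all-equal a)          = mismatch-refl a
  mismatch₁₂ (odd₁ a≢b)             = mismatch-≢ a≢b
  mismatch₁₂ (odd₂ a≢b)             = mismatch-≢ (≢-sym a≢b)
  mismatch₁₂ (odd₃ {b = b} _)       = mismatch-refl b
  mismatch₁₂ (all-distinct a≢b _ _) = mismatch-≢ a≢b

  mismatch₁₃ : ∀ {a b c} (σ : Shape a b c) → mismatch a c ≡ [odd₁] σ + [odd₃] σ + [distinct] σ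
  mismatch₁₃ (all-equal a)          = mismatch-refl a
  mismatch₁₃ (odd₁ a≢b)             = mismatch-≢ a≢b
  mismatch₁₃ (odd₂ {b = b} _)       = mismatch-refl b
  mismatch₁₃ (odd₃ a≢b)             = mismatch-≢ (≢-sym a≢b)
  mismatch₁₃ (all-distinct _ a≢c _) = mismatch-≢ a≢c

  mismatch₂₃ : ∀ {a b c} (σ : Shape a b c) → mismatch b c ≡ [odd₂] σ + [odd₃] σ + [distinct] σ
  mismatch₂₃ (all-equal a)          = mismatch-refl a
  mismatch₂₃ (odd₁ {b = b} _)       = mismatch-refl b
  mismatch₂₃ (odd₂ a≢b)             = mismatch-≢ a≢b
  mismatch₂₃ (odd₃ a≢b)             = mismatch-≢ (≢-sym a≢b)
  mismatch₂₃ (all-distinct _ _ b≢c) = mismatch-≢ b≢c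

  cost≤mismatches : ∀ {a b c} (σ : Shape a b c) x → cost σ ≤ mismatches x (a ∷ b ∷ c ∷ [])
  cost≤mismatches (all-equal a) x = z≤n
  cost≤mismatches (odd₁ {a} a≢b) x with x ≟ a
  ... | yes refl rewrite mismatch-≢ a≢b = s≤s z≤n
  ... | no  _    = s≤s z≤n
  cost≤mismatches (odd₂ {a} {b} a≢b) x with x ≟ b
  ... | yes refl rewrite mismatch-≢ (≢-sym a≢b) = s≤s z≤n
  ... | no  _    = s≤s z≤n
  cost≤mismatches (odd₃ {a} {b} a≢b) x with x ≟ b
  ... | yes refl rewrite mismatch-≢ (≢-sym a≢b) = s≤s z≤n
  ... | no  _    = s≤s z≤n
  cost≤mismatches (all-distinct {a} {b} a≢b a≢c b≢c) x with x ≟ a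
  ... | yes refl rewrite mismatch-≢ a≢b | mismatch-≢ a≢c = s≤s (s≤s z≤n)
  ... | no  _ with x ≟ b
  ...   | yes refl rewrite mismatch-≢ b≢c = s≤s (s≤s z≤n)
  ...   | no  _    = s≤s (s≤s z≤n)

variable
  c₁ c₂ c₃ n₁ n₂ n₃ n₄ d₁ d₂ d₃ e₁ e₂ e₃ : ℕ

-- Conditions (i) and (ii) for a triple with nⱼ columns whose only odd entry is the j-th
-- (j = 1, 2, 3) and n₄ columns of three distinct entries, against budgets d₁, d₂, d₃.
record Fits (n₁ n₂ n₃ n₄ d₁ d₂ d₃ : ℕ) : Set where
  constructor fits
  field
    fits₁₂     : n₁ + n₂ + n₄ ≤ d₁ + d₂
    fits₁₃     : n₁ + n₃ + n₄ ≤ d₁ + d₃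
    fits₂₃     : n₂ + n₃ + n₄ ≤ d₂ + d₃
    fits-total : n₁ + n₂ + n₃ + 2 * n₄ ≤ d₁ + d₂ + d₃

-- A character disagreeing exactly with the strings j with cⱼ = 1 can be chosen for the
-- current column: after paying for it, the remaining columns fit the leftover budgets.
data Spend (c₁ c₂ c₃ n₁ n₂ n₃ n₄ : ℕ) : ℕ → ℕ → ℕ → Set where
  spend : Fits n₁ n₂ n₃ n₄ e₁ e₂ e₃ → Spend c₁ c₂ c₃ n₁ n₂ n₃ n₄ (c₁ + e₁) (c₂ + e₂) (c₃ + e₃)

Fits-swap₁₂ : Fits n₁ n₂ n₃ n₄ d₁ d₂ d₃ → Fits n₂ n₁ n₃ n₄ d₂ d₁ d₃
Fits-swap₁₂ {n₁} {n₂} {n₃} {n₄} {d₁} {d₂} {d₃} (fits p₁₂ p₁₃ p₂₃ p) =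
  fits (≤-transfer 0 p₁₂ (solve (n₁ ∷ₗ n₂ ∷ₗ n₄ ∷ₗ d₁ ∷ₗ d₂ ∷ₗ []))) p₂₃ p₁₃
       (≤-transfer 0 p (solve (n₁ ∷ₗ n₂ ∷ₗ n₃ ∷ₗ n₄ ∷ₗ d₁ ∷ₗ d₂ ∷ₗ d₃ ∷ₗ [])))

Fits-swap₁₃ : Fits n₁ n₂ n₃ n₄ d₁ d₂ d₃ → Fits n₃ n₂ n₁ n₄ d₃ d₂ d₁
Fits-swap₁₃ {n₁} {n₂} {n₃} {n₄} {d₁} {d₂} {d₃} (fits p₁₂ p₁₃ p₂₃ p) =
  fits (≤-transfer 0 p₂₃ (solve (n₂ ∷ₗ n₃ ∷ₗ n₄ ∷ₗ d₂ ∷ₗ d₃ ∷ₗ [])))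
       (≤-transfer 0 p₁₃ (solve (n₁ ∷ₗ n₃ ∷ₗ n₄ ∷ₗ d₁ ∷ₗ d₃ ∷ₗ [])))
       (≤-transfer 0 p₁₂ (solve (n₁ ∷ₗ n₂ ∷ₗ n₄ ∷ₗ d₁ ∷ₗ d₂ ∷ₗ [])))
       (≤-transfer 0 p (solve (n₁ ∷ₗ n₂ ∷ₗ n₃ ∷ₗ n₄ ∷ₗ d₁ ∷ₗ d₂ ∷ₗ d₃ ∷ₗ [])))

Spend-swap₁₂ : Spend c₁ c₂ c₃ n₁ n₂ n₃ n₄ d₁ d₂ d₃ → Spend c₂ c₁ c₃ n₂ n₁ n₃ n₄ d₂ d₁ d₃
Spend-swap₁₂ (spend f) = spend (Fits-swap₁₂ f)

Spend-swap₁₃ : Spend c₁ c₂ c₃ n₁ n₂ n₃ n₄ d₁ d₂ d₃ → Spend c₃ c₂ c₁ n₃ n₂ n₁ n₄ d₃ d₂ d₁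
Spend-swap₁₃ (spend f) = spend (Fits-swap₁₃ f)

odd₁-step : Fits (suc n₁) n₂ n₃ n₄ d₁ d₂ d₃ →
  Spend 1 0 0 n₁ n₂ n₃ n₄ d₁ d₂ d₃ ⊎ Spend 0 1 1 n₁ n₂ n₃ n₄ d₁ d₂ d₃
odd₁-step {d₁ = suc _} (fits (s≤s p₁₂) (s≤s p₁₃) p₂₃ (s≤s p)) = inj₁ (spend (fits p₁₂ p₁₃ p₂₃ p))
odd₁-step {d₁ = zero} {d₂ = zero}                  (fits () _ _ _)
odd₁-step {d₁ = zero} {d₂ = suc _} {d₃ = zero}     (fits _ () _ _)
odd₁-step {n₁} {n₂} {n₃} {n₄} {zero} {suc e₂} {suc e₃} (fits (s≤s h₁₂) (s≤s h₁₃) _ _) =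
  inj₂ (spend (fits h₁₂ h₁₃
    (≤-transfer (n₁ + n₁ + n₄) (+-mono-≤ h₁₂ h₁₃) (solve (n₁ ∷ₗ n₂ ∷ₗ n₃ ∷ₗ n₄ ∷ₗ e₂ ∷ₗ e₃ ∷ₗ [])))
    (≤-transfer n₁ (+-mono-≤ h₁₂ h₁₃) (solve (n₁ ∷ₗ n₂ ∷ₗ n₃ ∷ₗ n₄ ∷ₗ e₂ ∷ₗ e₃ ∷ₗ [])))))

odd₂-step : Fits n₁ (suc n₂) n₃ n₄ d₁ d₂ d₃ →
  Spend 0 1 0 n₁ n₂ n₃ n₄ d₁ d₂ d₃ ⊎ Spend 1 0 1 n₁ n₂ n₃ n₄ d₁ d₂ d₃
odd₂-step = Sum.map Spend-swap₁₂ Spend-swap₁₂ ∘ odd₁-step ∘ Fits-swap₁₂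

odd₃-step : Fits n₁ n₂ (suc n₃) n₄ d₁ d₂ d₃ →
  Spend 0 0 1 n₁ n₂ n₃ n₄ d₁ d₂ d₃ ⊎ Spend 1 1 0 n₁ n₂ n₃ n₄ d₁ d₂ d₃
odd₃-step = Sum.map Spend-swap₁₃ Spend-swap₁₃ ∘ odd₁-step ∘ Fits-swap₁₃

SpendTwo : (n₁ n₂ n₃ n₄ d₁ d₂ d₃ : ℕ) → Set
SpendTwo n₁ n₂ n₃ n₄ d₁ d₂ d₃ =
  Spend 0 1 1 n₁ n₂ n₃ n₄ d₁ d₂ d₃ ⊎ Spend 1 0 1 n₁ n₂ n₃ n₄ d₁ d₂ d₃ ⊎ Spend 1 1 0 n₁ n₂ n₃ n₄ d₁ d₂ d₃

SpendTwo-swap₁₂ : SpendTwo n₁ n₂ n₃ n₄ d₁ d₂ d₃ → SpendTwo n₂ n₁ n₃ n₄ d₂ d₁ d₃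
SpendTwo-swap₁₂ (inj₁ s)        = inj₂ (inj₁ (Spend-swap₁₂ s))
SpendTwo-swap₁₂ (inj₂ (inj₁ s)) = inj₁ (Spend-swap₁₂ s)
SpendTwo-swap₁₂ (inj₂ (inj₂ s)) = inj₂ (inj₂ (Spend-swap₁₂ s))

SpendTwo-swap₁₃ : SpendTwo n₁ n₂ n₃ n₄ d₁ d₂ d₃ → SpendTwo n₃ n₂ n₁ n₄ d₃ d₂ d₁
SpendTwo-swap₁₃ (inj₁ s)        = inj₂ (inj₂ (Spend-swap₁₃ s))
SpendTwo-swap₁₃ (inj₂ (inj₁ s)) = inj₂ (inj₁ (Spend-swap₁₃ s))
SpendTwo-swap₁₃ (inj₂ (inj₂ s)) = inj₁ (Spend-swap₁₃ s)

-- With slack on the pair (2, 3), T₁'s character works unless d₂ or d₃ is 0; then T₂'s,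
-- respectively T₃'s, does.
distinct-step₂₃ : Fits n₁ n₂ n₃ (suc n₄) d₁ d₂ d₃ → 2 + (n₂ + n₃ + n₄) ≤ d₂ + d₃ →
  SpendTwo n₁ n₂ n₃ n₄ d₁ d₂ d₃
distinct-step₂₃ {n₁} {n₂} {n₃} {n₄} {d₁} {suc e₂} {suc e₃} (fits p₁₂ p₁₃ _ p) slack =
  inj₁ (spend (fits
    (≤-transfer 0 p₁₂ (solve (n₁ ∷ₗ n₂ ∷ₗ n₄ ∷ₗ d₁ ∷ₗ e₂ ∷ₗ [])))
    (≤-transfer 0 p₁₃ (solve (n₁ ∷ₗ n₃ ∷ₗ n₄ ∷ₗ d₁ ∷ₗ e₃ ∷ₗ [])))
    (≤-transfer 0 slack (solve (n₂ ∷ₗ n₃ ∷ₗ n₄ ∷ₗ e₂ ∷ₗ e₃ ∷ₗ [])))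
    (≤-transfer 0 p (solve (n₁ ∷ₗ n₂ ∷ₗ n₃ ∷ₗ n₄ ∷ₗ d₁ ∷ₗ e₂ ∷ₗ e₃ ∷ₗ [])))))
distinct-step₂₃ {n₁} {n₂} {n₃} {n₄} {suc e₁} {zero} {suc e₃} (fits p₁₂ _ _ p) slack =
  inj₂ (inj₁ (spend (fits
    (≤-transfer 0 p₁₂ (solve (n₁ ∷ₗ n₂ ∷ₗ n₄ ∷ₗ e₁ ∷ₗ [])))
    (≤-transfer (n₂ + n₂ + n₄ + 1) (+-mono-≤ p₁₂ slack) (solve (n₁ ∷ₗ n₂ ∷ₗ n₃ ∷ₗ n₄ ∷ₗ e₁ ∷ₗ e₃ ∷ₗ [])))
    (≤-transfer 1 slack (solve (n₂ ∷ₗ n₃ ∷ₗ n₄ ∷ₗ e₃ ∷ₗ [])))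
    (≤-transfer 0 p (solve (n₁ ∷ₗ n₂ ∷ₗ n₃ ∷ₗ n₄ ∷ₗ e₁ ∷ₗ e₃ ∷ₗ []))))))
distinct-step₂₃ {n₁} {n₂} {n₃} {n₄} {suc e₁} {suc e₂} {zero} (fits _ p₁₃ _ p) slack =
  inj₂ (inj₂ (spend (fits
    (≤-transfer (n₃ + n₃ + n₄ + 1) (+-mono-≤ p₁₃ slack) (solve (n₁ ∷ₗ n₂ ∷ₗ n₃ ∷ₗ n₄ ∷ₗ e₁ ∷ₗ e₂ ∷ₗ [])))
    (≤-transfer 0 p₁₃ (solve (n₁ ∷ₗ n₃ ∷ₗ n₄ ∷ₗ e₁ ∷ₗ [])))
    (≤-transfer 1 slack (solve (n₂ ∷ₗ n₃ ∷ₗ n₄ ∷ₗ e₂ ∷ₗ [])))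
    (≤-transfer 0 p (solve (n₁ ∷ₗ n₂ ∷ₗ n₃ ∷ₗ n₄ ∷ₗ e₁ ∷ₗ e₂ ∷ₗ []))))))
distinct-step₂₃ {d₂ = zero} {zero} _ ()
distinct-step₂₃ {n₁} {n₂} {n₃} {n₄} {zero} {zero} {suc _} (fits p₁₂ _ _ _) _ =
  contradiction (≤-transfer {a = 1} {b = 0} (n₁ + n₂ + n₄) p₁₂ (solve (n₁ ∷ₗ n₂ ∷ₗ n₄ ∷ₗ []))) λ ()
distinct-step₂₃ {n₁} {n₂} {n₃} {n₄} {zero} {suc _} {zero} (fits _ p₁₃ _ _) _ =
  contradiction (≤-transfer {a = 1} {b = 0} (n₁ + n₃ + n₄) p₁₃ (solve (n₁ ∷ₗ n₃ ∷ₗ n₄ ∷ₗ []))) λ ()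

-- Some pair has slack: otherwise the three tight pair conditions add up to contradict (ii).
distinct-step : Fits n₁ n₂ n₃ (suc n₄) d₁ d₂ d₃ → SpendTwo n₁ n₂ n₃ n₄ d₁ d₂ d₃
distinct-step {n₁} {n₂} {n₃} {n₄} {d₁} {d₂} {d₃} f@(fits _ _ _ total)
  with 2 + (n₂ + n₃ + n₄) ≤? d₂ + d₃ | 2 + (n₁ + n₃ + n₄) ≤? d₁ + d₃ | 2 + (n₂ + n₁ + n₄) ≤? d₂ + d₁
... | yes slack | _         | _         = distinct-step₂₃ f slack
... | no _      | yes slack | _         = SpendTwo-swap₁₂ (distinct-step₂₃ (Fits-swap₁₂ f) slack)
... | no _      | no _      | yes slack = SpendTwo-swap₁₃ (distinct-step₂₃ (Fits-swap₁₃ f) slack)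
... | no ¬s₂₃   | no ¬s₁₃   | no ¬s₁₂   = contradiction
  (≤-transfer {a = 1} {b = 0} n₄
    (+-mono-≤ (+-mono-≤ total total) (+-mono-≤ (+-mono-≤ (tight ¬s₂₃) (tight ¬s₁₃)) (tight ¬s₁₂)))
    (solve (n₁ ∷ₗ n₂ ∷ₗ n₃ ∷ₗ n₄ ∷ₗ d₁ ∷ₗ d₂ ∷ₗ d₃ ∷ₗ [])))
  λ ()
  where
  tight : ∀ {x y} → ¬ 2 + x ≤ y → y ≤ 1 + x
  tight = ≤-pred ∘ ≰⇒>

module _ {s l : ℕ} (u v w : LMer s l) where

  shapeAt : (i : Fin l) → Shape (lookup u i) (lookup v i) (lookup w i)
  shapeAt i = shape (lookup u i) (lookup v i) (lookup w i)

  #odd₁ #odd₂ #odd₃ #distinct : ℕ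
  #odd₁    = ∑[ i < l ] [odd₁] (shapeAt i)
  #odd₂    = ∑[ i < l ] [odd₂] (shapeAt i)
  #odd₃    = ∑[ i < l ] [odd₃] (shapeAt i)
  #distinct = ∑[ i < l ] [distinct] (shapeAt i)

  Hd≡#₁₂ : Hd u v ≡ #odd₁ + #odd₂ + #distinct
  Hd≡#₁₂ = trans (Hd≡∑mismatch u v) (trans (sum-cong-≗ (mismatch₁₂ ∘ shapeAt))
    (∑-distrib-+₃ ([odd₁] ∘ shapeAt) ([odd₂] ∘ shapeAt) ([distinct] ∘ shapeAt)))

  Hd≡#₁₃ : Hd u w ≡ #odd₁ + #odd₃ + #distinct
  Hd≡#₁₃ = trans (Hd≡∑mismatch u w) (trans (sum-cong-≗ (mismatch₁₃ ∘ shapeAt))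
    (∑-distrib-+₃ ([odd₁] ∘ shapeAt) ([odd₃] ∘ shapeAt) ([distinct] ∘ shapeAt)))

  Hd≡#₂₃ : Hd v w ≡ #odd₂ + #odd₃ + #distinct
  Hd≡#₂₃ = trans (Hd≡∑mismatch v w) (trans (sum-cong-≗ (mismatch₂₃ ∘ shapeAt))
    (∑-distrib-+₃ ([odd₂] ∘ shapeAt) ([odd₃] ∘ shapeAt) ([distinct] ∘ shapeAt)))

  ∑cost≡# : ∑[ i < l ] cost (shapeAt i) ≡ #odd₁ + #odd₂ + #odd₃ + 2 * #distinct
  ∑cost≡# = trans (∑-distrib-+ (λ i → [odd₁] (shapeAt i) + [odd₂] (shapeAt i) + [odd₃] (shapeAt i))
                               (λ i → 2 * [distinct] (shapeAt i)))
    (cong₂ _+_ (∑-distrib-+₃ ([odd₁] ∘ shapeAt) ([odd₂] ∘ shapeAt) ([odd₃] ∘ shapeAt))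
               (sym (*-distribˡ-sum 2 ([distinct] ∘ shapeAt))))

  #cost≤Cd : #odd₁ + #odd₂ + #odd₃ + 2 * #distinct ≤ Cd (u ∷ v ∷ w ∷ [])
  #cost≤Cd = begin
    #odd₁ + #odd₂ + #odd₃ + 2 * #distinct                ≡⟨ ∑cost≡# ⟨
    ∑[ i < l ] cost (shapeAt i)                          ≤⟨ ∑-mono-≤ (λ i → ≤∸maxMult _ _ (cost≤mismatches (shapeAt i))) ⟩
    ∑[ i < l ] (3 ∸ maxMult (column (u ∷ v ∷ w ∷ []) i)) ≡⟨ Cd≡∑ (u ∷ v ∷ w ∷ []) ⟨
    Cd (u ∷ v ∷ w ∷ [])                                  ∎
    where open ≤-Reasoning

  counts-fit : ∀ {d₁ d₂ d₃} → Hd u v ≤ d₁ + d₂ → Hd u w ≤ d₁ + d₃ → Hd v w ≤ d₂ + d₃ →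
    Cd (u ∷ v ∷ w ∷ []) ≤ d₁ + d₂ + d₃ → Fits #odd₁ #odd₂ #odd₃ #distinct d₁ d₂ d₃
  counts-fit h₁₂ h₁₃ h₂₃ h = fits
    (subst (_≤ _) Hd≡#₁₂ h₁₂) (subst (_≤ _) Hd≡#₁₃ h₁₃) (subst (_≤ _) Hd≡#₂₃ h₂₃) (≤-trans #cost≤Cd h)

module _ {s : ℕ} where

  Center : ∀ {l} (u v w : LMer s l) (d₁ d₂ d₃ : ℕ) → Set
  Center {l} u v w d₁ d₂ d₃ = ∃ λ (M : LMer s l) → Hd M u ≤ d₁ × Hd M v ≤ d₂ × Hd M w ≤ d₃

  Hd-∷-≤ : ∀ {l} {m a : Fin s} {M u : LMer s l} {e} → Hd M u ≤ e → Hd (m ∷ M) (a ∷ u) ≤ mismatch m a + e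
  Hd-∷-≤ {m = m} {a} {M} {u} h = subst (_≤ _) (sym (Hd-∷ m a M u)) (+-monoʳ-≤ (mismatch m a) h)

  extend : ∀ {l} {a b c : Fin s} {u v w : LMer s l} (m : Fin s) →
    mismatch m a ≡ c₁ → mismatch m b ≡ c₂ → mismatch m c ≡ c₃ →
    (∀ {e₁ e₂ e₃} → Fits n₁ n₂ n₃ n₄ e₁ e₂ e₃ → Center u v w e₁ e₂ e₃) →
    Spend c₁ c₂ c₃ n₁ n₂ n₃ n₄ d₁ d₂ d₃ → Center (a ∷ u) (b ∷ v) (c ∷ w) d₁ d₂ d₃
  extend m refl refl refl rest (spend f) with rest f
  ... | M , h₁ , h₂ , h₃ = m ∷ M , Hd-∷-≤ h₁ , Hd-∷-≤ h₂ , Hd-∷-≤ h₃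

  center : ∀ {l} (u v w : LMer s l) →
    Fits (#odd₁ u v w) (#odd₂ u v w) (#odd₃ u v w) (#distinct u v w) d₁ d₂ d₃ → Center u v w d₁ d₂ d₃
  center []      []      []      _ = [] , z≤n , z≤n , z≤n
  center (a ∷ u) (b ∷ v) (c ∷ w) f with shape a b c
  ... | all-equal _ = extend a (mismatch-refl a) (mismatch-refl a) (mismatch-refl a) (center u v w) (spend f)
  ... | odd₁ a≢b with odd₁-step f
  ...   | inj₁ s₁ = extend b (mismatch-≢ (≢-sym a≢b)) (mismatch-refl b) (mismatch-refl b) (center u v w) s₁
  ...   | inj₂ s₂₃ = extend a (mismatch-refl a) (mismatch-≢ a≢b) (mismatch-≢ a≢b) (center u v w) s₂₃
  center (a ∷ u) (b ∷ v) (c ∷ w) f | odd₂ b≢a with odd₂-step f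
  ...   | inj₁ s₂ = extend a (mismatch-refl a) (mismatch-≢ (≢-sym b≢a)) (mismatch-refl a) (center u v w) s₂
  ...   | inj₂ s₁₃ = extend b (mismatch-≢ b≢a) (mismatch-refl b) (mismatch-≢ b≢a) (center u v w) s₁₃
  center (a ∷ u) (b ∷ v) (c ∷ w) f | odd₃ c≢a with odd₃-step f
  ...   | inj₁ s₃ = extend a (mismatch-refl a) (mismatch-refl a) (mismatch-≢ (≢-sym c≢a)) (center u v w) s₃
  ...   | inj₂ s₁₂ = extend c (mismatch-≢ c≢a) (mismatch-≢ c≢a) (mismatch-refl c) (center u v w) s₁₂
  center (a ∷ u) (b ∷ v) (c ∷ w) f | all-distinct a≢b a≢c b≢c with distinct-step f
  ...   | inj₁ s₂₃ =
    extend a (mismatch-refl a) (mismatch-≢ a≢b) (mismatch-≢ a≢c) (center u v w) s₂₃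
  ...   | inj₂ (inj₁ s₁₃) =
    extend b (mismatch-≢ (≢-sym a≢b)) (mismatch-refl b) (mismatch-≢ b≢c) (center u v w) s₁₃
  ...   | inj₂ (inj₂ s₁₂) =
    extend c (mismatch-≢ (≢-sym a≢c)) (mismatch-≢ (≢-sym b≢c)) (mismatch-refl c) (center u v w) s₁₂

theorem1 : (s l : ℕ) → 1 ≤ l → (T₁ T₂ T₃ : LMer s l) → (d₁ d₂ d₃ : ℕ) →
    (∃ λ (M : LMer s l) → Hd M T₁ ≤ d₁ × Hd M T₂ ≤ d₂ × Hd M T₃ ≤ d₃)
    ⇔ ((Cd (T₁ ∷ T₂ ∷ []) ≤ d₁ + d₂ × Cd (T₁ ∷ T₃ ∷ []) ≤ d₁ + d₃ × Cd (T₂ ∷ T₃ ∷ []) ≤ d₂ + d₃)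
       × Cd (T₁ ∷ T₂ ∷ T₃ ∷ []) ≤ d₁ + d₂ + d₃)
theorem1 s l _ T₁ T₂ T₃ d₁ d₂ d₃ = mk⇔
  (λ { (M , h₁ , h₂ , h₃) →
         (Cd-pair≤ M h₁ h₂ , Cd-pair≤ M h₁ h₃ , Cd-pair≤ M h₂ h₃) , Cd-triple≤ M h₁ h₂ h₃ })
  (λ { ((p₁₂ , p₁₃ , p₂₃) , p) → center T₁ T₂ T₃
         (counts-fit T₁ T₂ T₃ (≤-trans (Hd≤Cd T₁ T₂) p₁₂) (≤-trans (Hd≤Cd T₁ T₃) p₁₃)
                              (≤-trans (Hd≤Cd T₂ T₃) p₂₃) p) })
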